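{- Let $M$ be a matroid on an $n$-element ground set $E$. For each $1\le i\le n-r(M)$, \[d_i(M)=\min\{s:\deg P_{M,s}=i\}.\]
   Context: For a matroid $M$ on $E$ with rank function $r$, the nullity is $n(\sigma)=|\sigma|-r(\sigma)$ and $r(M)=r(E)$. The higher weights are $d_i(M)=\min\{|\sigma|:\sigma\subseteq E,\ n(\sigma)=i\}$. Generalized weight polynomials: $P_{M,0}(Z)=1$ and, for $1\le j\le n$, $P_{M,j}(Z)=(-1)^j\sum_{\sigma\subseteq E,\,|\sigma|=j}\sum_{\gamma\subseteq\sigma}(-1)^{|\gamma|}Z^{n(\gamma)}$. -}

module Defs where

open import Data.Nat using (ℕ; zero; suc; _≤_; _<_; _∸_; _≟_)
open import Data.Integer as ℤ using (ℤ; +_; -_)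
open import Data.Bool using (Bool; true; false; if_then_else_)
open import Data.List using (List; []; _∷_; _++_; map; sum)
open import Data.Vec using ([]; _∷_)
open import Data.Fin.Subset using (Subset; ⊤; ∣_∣; _⊆_; _∪_; _∩_; inside; outside)
open import Data.Product using (Σ; _×_; Σ-syntax)
open import Relation.Binary.PropositionalEquality using (_≡_; _≢_)
open import Relation.Nullary.Decidable using (⌊_⌋)

record Matroid (n : ℕ) : Set where
  field
    rank      : Subset n → ℕ
    rank-≤    : ∀ X → rank X ≤ ∣ X ∣
    rank-mono : ∀ {X Y} → X ⊆ Y → rank X ≤ rank Y
    rank-sub  : ∀ X Y → rank (X ∪ Y) Data.Nat.+ rank (X ∩ Y) ≤ rank X Data.Nat.+ rank Y
open Matroid public

rankM : ∀ {n} → Matroid n → ℕ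
rankM M = rank M ⊤

nullity : ∀ {n} → Matroid n → Subset n → ℕ
nullity M σ = ∣ σ ∣ ∸ rank M σ

subsetsOf : ∀ {n} → Subset n → List (Subset n)
subsetsOf [] = [] ∷ []
subsetsOf (false ∷ s) = map (outside ∷_) (subsetsOf s)
subsetsOf (true ∷ s)  = map (outside ∷_) (subsetsOf s) ++ map (inside ∷_) (subsetsOf s)

allSubsets : ∀ n → List (Subset n)
allSubsets n = subsetsOf (⊤ {n})

sumℤ : List ℤ → ℤ
sumℤ [] = + 0
sumℤ (x ∷ xs) = x ℤ.+ sumℤ xs

sign : ℕ → ℤ
sign zero = + 1
sign (suc k) = - sign k

-- Coefficient of Z^k in P_{M,j}(Z) =
--   (-1)^j Σ_{|σ|=j} Σ_{γ⊆σ} (-1)^{|γ|} Z^{n(γ)}.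
-- (For j = 0 this formula gives exactly the constant polynomial 1.)
coeffP : ∀ {n} → Matroid n → (j k : ℕ) → ℤ
coeffP {n} M j k =
  sign j ℤ.* sumℤ (map (λ σ → if ⌊ ∣ σ ∣ ≟ j ⌋
                               then sumℤ (map (λ γ → if ⌊ nullity M γ ≟ k ⌋ then sign ∣ γ ∣ else + 0)
                                              (subsetsOf σ))
                               else + 0)
                        (allSubsets n))

-- deg P_{M,s} = i  (the zero polynomial has no degree)
DegP≡ : ∀ {n} → Matroid n → (s i : ℕ) → Set
DegP≡ M s i = (coeffP M s i ≢ + 0) × (∀ k → i < k → coeffP M s k ≡ + 0)

IsMin : (ℕ → Set) → ℕ → Set
IsMin P m = P m × (∀ s → P s → m ≤ s)

IsHigherWeight : ∀ {n} → Matroid n → (i m : ℕ) → Set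
IsHigherWeight {n} M i m = IsMin (λ s → Σ[ σ ∈ Subset n ] (∣ σ ∣ ≡ s × nullity M σ ≡ i)) m

module Submission where

-- The coefficient of Z^k in P_{M,s} is
--     (-1)^s Σ_{|σ| = s} Σ_{γ ⊆ σ, n(γ) = k} (-1)^{|γ|},
-- and two facts about it drive the proof (section "Coefficients"):
--   * if no set of size ≤ s has nullity k, the coefficient vanishes;
--   * if no set of size < s has nullity k, only γ = σ survives in each inner
--     sum, so the coefficient counts the s-sets of nullity k.
-- Removing one element lowers the nullity by at most one ("Descent"), so a
-- set of nullity > i contains a strictly smaller set of nullity exactly i.
-- For d = d_i(M) this gives: the Z^i-coefficient of P_{M,d} is a positive
-- count, all higher coefficients vanish, and the Z^i-coefficient of P_{M,s}
-- vanishes for s < d; hence d is the least s with deg P_{M,s} = i.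
-- The hypothesis i ≤ n - r(M), applied to the ground set, shows that d_i(M)
-- exists (as an argmin over the finite list of subsets), and since a minimum
-- is unique both sides of the equivalence describe the same number.

open import Defs
open import Data.Nat using (ℕ; _≤_; _∸_)
open import Function.Bundles using (_⇔_)

open import Data.Nat using (zero; suc; _<_; z≤n; s≤s; s≤s⁻¹; _≟_)
open import Data.Nat.Properties as ℕ
  using (≤-refl; ≤-trans; ≤-antisym; <⇒≱; ≮⇒≥; ≤∧≢⇒<; m∸n≤m; ∸-monoʳ-≤)
open import Data.Nat.ListAction using (sum)
open import Data.Integer as ℤ using (ℤ; +_; -_)
import Data.Integer.Properties as ℤ
open import Data.Bool using (if_then_else_)
open import Data.List using (List; []; _∷_; _++_; map; filter)
open import Data.List.Properties using (map-∘; map-cong)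
open import Data.List.Membership.Propositional using (_∈_)
open import Data.List.Membership.Propositional.Properties
  using (∈-map⁺; ∈-++⁺ˡ; ∈-++⁺ʳ; ∈-filter⁺)
open import Data.List.Relation.Unary.All using (lookup)
open import Data.List.Relation.Unary.All.Properties using (all-filter)
open import Data.List.Relation.Unary.Any using (here; there)
import Data.List.Extrema ℕ.≤-totalOrder as Extrema
open import Data.Vec as Vec using ([]; _∷_)
open import Data.Fin.Subset using (Subset; ⊤; ∣_∣; _⊆_; inside; outside)
open import Data.Fin.Subset.Properties using (∣⊤∣≡n)
open import Data.Product using (_×_; _,_; proj₁; proj₂; map₂; Σ-syntax)
open import Data.Empty using (⊥-elim)
open import Relation.Nullary using (yes; no)
open import Relation.Nullary.Decidable using (⌊_⌋)
open import Relation.Binary.PropositionalEquality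
open import Function.Bundles using (mk⇔)

private variable
  A B : Set
  n : ℕ

∑ : (A → ℤ) → List A → ℤ
∑ f xs = sumℤ (map f xs)

∑-++ : ∀ (f : A → ℤ) xs ys → ∑ f (xs ++ ys) ≡ ∑ f xs ℤ.+ ∑ f ys
∑-++ f [] ys = sym (ℤ.+-identityˡ _)
∑-++ f (x ∷ xs) ys =
  trans (cong (λ t → f x ℤ.+ t) (∑-++ f xs ys)) (sym (ℤ.+-assoc (f x) _ _))

∑-map : ∀ (f : B → ℤ) (g : A → B) xs → ∑ f (map g xs) ≡ ∑ (λ x → f (g x)) xs
∑-map f g xs = cong sumℤ (sym (map-∘ xs))

∑-cong : ∀ {f g : A → ℤ} → (∀ x → f x ≡ g x) → ∀ xs → ∑ f xs ≡ ∑ g xs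
∑-cong f≗g xs = cong sumℤ (map-cong f≗g xs)

∑-zero : ∀ (f : A → ℤ) → (∀ x → f x ≡ + 0) → ∀ xs → ∑ f xs ≡ + 0
∑-zero f f≡0 xs = trans (∑-cong f≡0 xs) (vanish xs)
  where
    vanish : ∀ xs → ∑ (λ _ → + 0) xs ≡ + 0
    vanish [] = refl
    vanish (_ ∷ xs) = trans (ℤ.+-identityˡ _) (vanish xs)

∑-scale : ∀ (c : ℤ) (h : A → ℕ) xs → ∑ (λ x → c ℤ.* + h x) xs ≡ c ℤ.* + sum (map h xs)
∑-scale c h [] = sym (ℤ.*-zeroʳ c)
∑-scale c h (x ∷ xs) =
  trans (cong (λ t → c ℤ.* + h x ℤ.+ t) (∑-scale c h xs))
        (sym (ℤ.*-distribˡ-+ c (+ h x) (+ sum (map h xs))))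

∈⇒≤sum : ∀ (h : A → ℕ) {x xs} → x ∈ xs → h x ≤ sum (map h xs)
∈⇒≤sum h (here refl) = ℕ.m≤m+n _ _
∈⇒≤sum h {xs = y ∷ _} (there x∈xs) = ≤-trans (∈⇒≤sum h x∈xs) (ℕ.m≤n+m _ (h y))

-- ((-1)^k)^2 = 1: the sign of P_{M,s} cancels the sign of its top terms.
sign-sq : ∀ k → sign k ℤ.* sign k ≡ + 1
sign-sq zero = refl
sign-sq (suc k) = begin
  - sign k ℤ.* - sign k     ≡⟨ sym (ℤ.neg-distribˡ-* (sign k) (- sign k)) ⟩
  - (sign k ℤ.* - sign k)   ≡⟨ cong -_ (sym (ℤ.neg-distribʳ-* (sign k) (sign k))) ⟩
  - - (sign k ℤ.* sign k)   ≡⟨ ℤ.neg-involutive _ ⟩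
  sign k ℤ.* sign k         ≡⟨ sign-sq k ⟩
  + 1                       ∎
  where open ≡-Reasoning

∑-subsetsOf-top : ∀ (σ : Subset n) (f : Subset n → ℤ) →
  (∀ γ → ∣ γ ∣ < ∣ σ ∣ → f γ ≡ + 0) → ∑ f (subsetsOf σ) ≡ f σ
∑-subsetsOf-top [] f _ = ℤ.+-identityʳ (f [])
∑-subsetsOf-top (outside ∷ s) f small≡0 =
  trans (∑-map f (outside ∷_) (subsetsOf s))
        (∑-subsetsOf-top s (λ γ → f (outside ∷ γ)) (λ γ → small≡0 (outside ∷ γ)))
∑-subsetsOf-top (inside ∷ s) f small≡0 = begin
  ∑ f (map (outside ∷_) (subsetsOf s) ++ map (inside ∷_) (subsetsOf s))
    ≡⟨ ∑-++ f (map (outside ∷_) (subsetsOf s)) _ ⟩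
  ∑ f (map (outside ∷_) (subsetsOf s)) ℤ.+ ∑ f (map (inside ∷_) (subsetsOf s))
    ≡⟨ cong₂ ℤ._+_ (∑-map f (outside ∷_) (subsetsOf s)) (∑-map f (inside ∷_) (subsetsOf s)) ⟩
  ∑ (λ γ → f (outside ∷ γ)) (subsetsOf s) ℤ.+ ∑ (λ γ → f (inside ∷ γ)) (subsetsOf s)
    ≡⟨ cong₂ ℤ._+_ without-first with-first ⟩
  + 0 ℤ.+ f (inside ∷ s)
    ≡⟨ ℤ.+-identityˡ _ ⟩
  f (inside ∷ s) ∎
  where
    open ≡-Reasoning
    -- subsets avoiding the first element are all smaller than σ, including s itself
    without-first : ∑ (λ γ → f (outside ∷ γ)) (subsetsOf s) ≡ + 0
    without-first =
      trans (∑-subsetsOf-top s (λ γ → f (outside ∷ γ)) (λ γ γ<s → small≡0 (outside ∷ γ) (ℕ.m<n⇒m<1+n γ<s)))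
            (small≡0 (outside ∷ s) ≤-refl)
    with-first : ∑ (λ γ → f (inside ∷ γ)) (subsetsOf s) ≡ f (inside ∷ s)
    with-first = ∑-subsetsOf-top s (λ γ → f (inside ∷ γ)) (λ γ γ<s → small≡0 (inside ∷ γ) (s≤s γ<s))

∈-allSubsets : ∀ (γ : Subset n) → γ ∈ allSubsets n
∈-allSubsets [] = here refl
∈-allSubsets {suc n} (outside ∷ γ) = ∈-++⁺ˡ (∈-map⁺ (outside ∷_) (∈-allSubsets γ))
∈-allSubsets {suc n} (inside ∷ γ) =
  ∈-++⁺ʳ (map (outside ∷_) (allSubsets n)) (∈-map⁺ (inside ∷_) (∈-allSubsets γ))

-- Removing the first element of a set (the set is unchanged when empty).
dropFirst : Subset n → Subset n
dropFirst [] = []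
dropFirst (inside ∷ p) = outside ∷ p
dropFirst (outside ∷ p) = outside ∷ dropFirst p

dropFirst-⊆ : ∀ (X : Subset n) → dropFirst X ⊆ X
dropFirst-⊆ (inside ∷ p) (Vec.there x∈p) = Vec.there x∈p
dropFirst-⊆ (outside ∷ p) (Vec.there x∈p) = Vec.there (dropFirst-⊆ p x∈p)

dropFirst-size : ∀ (X : Subset n) → 0 < ∣ X ∣ → suc ∣ dropFirst X ∣ ≡ ∣ X ∣
dropFirst-size (inside ∷ p) _ = refl
dropFirst-size (outside ∷ p) 0<∣p∣ = dropFirst-size p 0<∣p∣

suc-∸-≤ : ∀ a b → suc a ∸ b ≤ suc (a ∸ b)
suc-∸-≤ a zero = ≤-refl
suc-∸-≤ zero (suc b) = ≤-trans (m∸n≤m 0 b) z≤n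
suc-∸-≤ (suc a) (suc b) = suc-∸-≤ a b

module Descent {n} (M : Matroid n) where

  -- Deleting one element lowers the nullity by at most one: the size drops by
  -- one and, by monotonicity, the rank does not grow.
  nullity-dropFirst : ∀ X → 0 < ∣ X ∣ → nullity M X ≤ suc (nullity M (dropFirst X))
  nullity-dropFirst X 0<∣X∣ = begin
    ∣ X ∣ ∸ rank M X                      ≤⟨ ∸-monoʳ-≤ ∣ X ∣ (rank-mono M (dropFirst-⊆ X)) ⟩
    ∣ X ∣ ∸ rank M X'                     ≡⟨ cong (_∸ rank M X') (sym (dropFirst-size X 0<∣X∣)) ⟩
    suc ∣ X' ∣ ∸ rank M X'                ≤⟨ suc-∸-≤ ∣ X' ∣ (rank M X') ⟩
    suc (∣ X' ∣ ∸ rank M X')              ∎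
    where
      open ℕ.≤-Reasoning
      X' : Subset n
      X' = dropFirst X

  nullity≤size : ∀ X → nullity M X ≤ ∣ X ∣
  nullity≤size X = m∸n≤m ∣ X ∣ (rank M X)

  nonempty : ∀ {i} X → i < nullity M X → 0 < ∣ X ∣
  nonempty X i<nX = ℕ.<-≤-trans (ℕ.≤-<-trans z≤n i<nX) (nullity≤size X)

  -- Discrete intermediate value property, by induction on a bound k for the
  -- size: deleting elements one at a time passes through every nullity.
  descend-bounded : ∀ i k X → ∣ X ∣ ≤ k → i ≤ nullity M X →
    Σ[ Y ∈ Subset n ] (nullity M Y ≡ i × ∣ Y ∣ ≤ ∣ X ∣)
  descend-strict-bounded : ∀ i k X → ∣ X ∣ ≤ k → i < nullity M X →
    Σ[ Y ∈ Subset n ] (nullity M Y ≡ i × ∣ Y ∣ < ∣ X ∣)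

  descend-bounded i k X ∣X∣≤k i≤nX with nullity M X ≟ i
  ... | yes nX≡i = X , nX≡i , ≤-refl
  ... | no nX≢i =
    map₂ (map₂ ℕ.<⇒≤) (descend-strict-bounded i k X ∣X∣≤k (≤∧≢⇒< i≤nX (≢-sym nX≢i)))

  descend-strict-bounded i zero X ∣X∣≤0 i<nX = ⊥-elim (<⇒≱ (nonempty X i<nX) ∣X∣≤0)
  descend-strict-bounded i (suc k) X ∣X∣≤1+k i<nX =
    map₂ (map₂ (λ ∣Y∣≤∣X'∣ → ℕ.≤-<-trans ∣Y∣≤∣X'∣ ∣X'∣<∣X∣)) (descend-bounded i k X' ∣X'∣≤k i≤nX')
    where
      X' : Subset n
      X' = dropFirst X
      ∣X'∣<∣X∣ : ∣ X' ∣ < ∣ X ∣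
      ∣X'∣<∣X∣ = ℕ.≤-reflexive (dropFirst-size X (nonempty X i<nX))
      ∣X'∣≤k : ∣ X' ∣ ≤ k
      ∣X'∣≤k = s≤s⁻¹ (≤-trans ∣X'∣<∣X∣ ∣X∣≤1+k)
      i≤nX' : i ≤ nullity M X'
      i≤nX' = s≤s⁻¹ (≤-trans i<nX (nullity-dropFirst X (nonempty X i<nX)))

  descend : ∀ i X → i ≤ nullity M X → Σ[ Y ∈ Subset n ] (nullity M Y ≡ i × ∣ Y ∣ ≤ ∣ X ∣)
  descend i X = descend-bounded i ∣ X ∣ X ≤-refl

  descend-strict : ∀ i X → i < nullity M X → Σ[ Y ∈ Subset n ] (nullity M Y ≡ i × ∣ Y ∣ < ∣ X ∣)
  descend-strict i X = descend-strict-bounded i ∣ X ∣ X ≤-refl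

module Coefficients {n} (M : Matroid n) where

  term : ℕ → Subset n → ℤ
  term k γ = if ⌊ nullity M γ ≟ k ⌋ then sign ∣ γ ∣ else + 0

  layer : ℕ → ℕ → Subset n → ℤ
  layer s k σ = if ⌊ ∣ σ ∣ ≟ s ⌋ then ∑ (term k) (subsetsOf σ) else + 0

  hasNullity : ℕ → Subset n → ℕ
  hasNullity k γ = if ⌊ nullity M γ ≟ k ⌋ then 1 else 0

  isWitness : ℕ → ℕ → Subset n → ℕ
  isWitness s k σ = if ⌊ ∣ σ ∣ ≟ s ⌋ then hasNullity k σ else 0

  witnesses : ℕ → ℕ → ℕ
  witnesses s k = sum (map (isWitness s k) (allSubsets n))

  term-as-indicator : ∀ k γ → term k γ ≡ sign ∣ γ ∣ ℤ.* + hasNullity k γ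
  term-as-indicator k γ with nullity M γ ≟ k
  ... | yes _ = sym (ℤ.*-identityʳ (sign ∣ γ ∣))
  ... | no _ = sym (ℤ.*-zeroʳ (sign ∣ γ ∣))

  witnesses-pos : ∀ s k → Σ[ σ ∈ Subset n ] (∣ σ ∣ ≡ s × nullity M σ ≡ k) → 0 < witnesses s k
  witnesses-pos s k (σ , ∣σ∣≡s , nσ≡k) = ℕ.<-≤-trans σ-counted (∈⇒≤sum (isWitness s k) (∈-allSubsets σ))
    where
      σ-counted : 0 < isWitness s k σ
      σ-counted with ∣ σ ∣ ≟ s | nullity M σ ≟ k
      ... | yes _ | yes _ = s≤s z≤n
      ... | no ∣σ∣≢s | _ = ⊥-elim (∣σ∣≢s ∣σ∣≡s)
      ... | yes _ | no nσ≢k = ⊥-elim (nσ≢k nσ≡k)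

  coeff-vanish : ∀ s k → (∀ γ → ∣ γ ∣ ≤ s → nullity M γ ≢ k) → coeffP M s k ≡ + 0
  coeff-vanish s k none =
    trans (cong (sign s ℤ.*_) (∑-zero (layer s k) layer≡0 (allSubsets n))) (ℤ.*-zeroʳ (sign s))
    where
      term≡0 : ∀ γ → ∣ γ ∣ ≤ s → term k γ ≡ + 0
      term≡0 γ ∣γ∣≤s with nullity M γ ≟ k
      ... | yes nγ≡k = ⊥-elim (none γ ∣γ∣≤s nγ≡k)
      ... | no _ = refl
      layer≡0 : ∀ σ → layer s k σ ≡ + 0
      layer≡0 σ with ∣ σ ∣ ≟ s
      ... | no _ = refl
      ... | yes ∣σ∣≡s = trans
        (∑-subsetsOf-top σ (term k) (λ γ γ<σ → term≡0 γ (≤-trans (ℕ.<⇒≤ γ<σ) (ℕ.≤-reflexive ∣σ∣≡s))))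
        (term≡0 σ (ℕ.≤-reflexive ∣σ∣≡s))

  -- If no set of size < s has nullity k, only the top term γ = σ of each
  -- inner sum survives; it equals (-1)^s, and the signs cancel.
  coeff-count : ∀ s k → (∀ γ → nullity M γ ≡ k → s ≤ ∣ γ ∣) → coeffP M s k ≡ + witnesses s k
  coeff-count s k large = begin
    sign s ℤ.* ∑ (layer s k) (allSubsets n)
      ≡⟨ cong (sign s ℤ.*_) (∑-cong layer≡ (allSubsets n)) ⟩
    sign s ℤ.* ∑ (λ σ → sign s ℤ.* + isWitness s k σ) (allSubsets n)
      ≡⟨ cong (sign s ℤ.*_) (∑-scale (sign s) (isWitness s k) (allSubsets n)) ⟩
    sign s ℤ.* (sign s ℤ.* + witnesses s k)
      ≡⟨ sym (ℤ.*-assoc (sign s) (sign s) _) ⟩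
    (sign s ℤ.* sign s) ℤ.* + witnesses s k
      ≡⟨ cong (ℤ._* + witnesses s k) (sign-sq s) ⟩
    + 1 ℤ.* + witnesses s k
      ≡⟨ ℤ.*-identityˡ _ ⟩
    + witnesses s k ∎
    where
      open ≡-Reasoning
      small≡0 : ∀ γ → ∣ γ ∣ < s → term k γ ≡ + 0
      small≡0 γ ∣γ∣<s with nullity M γ ≟ k
      ... | yes nγ≡k = ⊥-elim (<⇒≱ ∣γ∣<s (large γ nγ≡k))
      ... | no _ = refl
      layer≡ : ∀ σ → layer s k σ ≡ sign s ℤ.* + isWitness s k σ
      layer≡ σ with ∣ σ ∣ ≟ s
      ... | no _ = sym (ℤ.*-zeroʳ (sign s))
      ... | yes ∣σ∣≡s = trans
        (∑-subsetsOf-top σ (term k) (λ γ γ<σ → small≡0 γ (subst (∣ γ ∣ <_) ∣σ∣≡s γ<σ)))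
        (trans (term-as-indicator k σ) (cong (λ t → sign t ℤ.* + hasNullity k σ) ∣σ∣≡s))

IsMin-unique : ∀ {P : ℕ → Set} {a b} → IsMin P a → IsMin P b → a ≡ b
IsMin-unique (Pa , a-least) (Pb , b-least) = ≤-antisym (a-least _ Pb) (b-least _ Pa)

-- d_i(M) exists as soon as some set has nullity ≥ i: by descent some set has
-- nullity exactly i, and a smallest one is an argmin over the finite list of
-- all sets of nullity i.
higherWeight-exists : ∀ (M : Matroid n) i X → i ≤ nullity M X → Σ[ d ∈ ℕ ] IsHigherWeight M i d
higherWeight-exists {n} M i X i≤nX =
  ∣ σ* ∣ , (σ* , refl , nσ*≡i) , λ s (σ , ∣σ∣≡s , nσ≡i) → subst (∣ σ* ∣ ≤_) ∣σ∣≡s (σ*-smallest σ nσ≡i)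
  where
    Y : Subset n
    Y = proj₁ (Descent.descend M i X i≤nX)
    nY≡i : nullity M Y ≡ i
    nY≡i = proj₁ (proj₂ (Descent.descend M i X i≤nX))
    candidates : List (Subset n)
    candidates = filter (λ σ → nullity M σ ≟ i) (allSubsets n)
    σ* : Subset n
    σ* = Extrema.argmin ∣_∣ Y candidates
    nσ*≡i : nullity M σ* ≡ i
    nσ*≡i = Extrema.argmin-all ∣_∣ {P = λ σ → nullity M σ ≡ i} nY≡i
              (all-filter (λ σ → nullity M σ ≟ i) (allSubsets n))
    σ*-smallest : ∀ σ → nullity M σ ≡ i → ∣ σ* ∣ ≤ ∣ σ ∣
    σ*-smallest σ nσ≡i =
      lookup (Extrema.f[argmin]≤f[xs] Y candidates) (∈-filter⁺ (λ σ → nullity M σ ≟ i) (∈-allSubsets σ) nσ≡i)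

module AtHigherWeight {n} (M : Matroid n) {i d : ℕ} (d-is-dᵢ : IsHigherWeight M i d) where
  open Coefficients M
  open Descent M

  minimal : ∀ σ → nullity M σ ≡ i → d ≤ ∣ σ ∣
  minimal σ nσ≡i = proj₂ d-is-dᵢ ∣ σ ∣ (σ , refl , nσ≡i)

  -- Below d no set has nullity i, so P_{M,s} has no Z^i term.
  coeff-below : ∀ s → s < d → coeffP M s i ≡ + 0
  coeff-below s s<d = coeff-vanish s i
    (λ γ ∣γ∣≤s nγ≡i → <⇒≱ s<d (≤-trans (minimal γ nγ≡i) ∣γ∣≤s))

  -- A set of size ≤ d and nullity k > i would contain a smaller set of nullity i.
  coeff-above : ∀ k → i < k → coeffP M d k ≡ + 0
  coeff-above k i<k = coeff-vanish d k no-large-nullity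
    where
      no-large-nullity : ∀ γ → ∣ γ ∣ ≤ d → nullity M γ ≢ k
      no-large-nullity γ ∣γ∣≤d nγ≡k with Y , nY≡i , ∣Y∣<∣γ∣ ← descend-strict i γ (subst (i <_) (sym nγ≡k) i<k)
        = <⇒≱ (ℕ.<-≤-trans ∣Y∣<∣γ∣ ∣γ∣≤d) (minimal Y nY≡i)

  -- The Z^i-coefficient counts the d-sets of nullity i, and there is one.
  coeff-top : coeffP M d i ≢ + 0
  coeff-top coeff≡0 = ℕ.<⇒≢ (witnesses-pos d i (proj₁ d-is-dᵢ))
    (sym (ℤ.+-injective (trans (sym (coeff-count d i minimal)) coeff≡0)))

  least-degree : IsMin (λ s → DegP≡ M s i) d
  least-degree = (coeff-top , coeff-above) , λ s (coeff≢0 , _) → ≮⇒≥ (λ s<d → coeff≢0 (coeff-below s s<d))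

proposition5 : ∀ {n} (M : Matroid n) (i : ℕ) → 1 ≤ i → i ≤ n ∸ rankM M →
    ∀ m → IsHigherWeight M i m ⇔ IsMin (λ s → DegP≡ M s i) m
proposition5 M i _ i≤n∸r _ =
  mk⇔ (AtHigherWeight.least-degree M)
      (λ m-least → subst (IsHigherWeight M i) (IsMin-unique d-least m-least) d-is-dᵢ)
  where
    -- the ground set E has nullity n - r(M) ≥ i, so d = d_i(M) exists
    i≤nullity[E] : i ≤ nullity M ⊤
    i≤nullity[E] = subst (λ size → i ≤ size ∸ rankM M) (sym (∣⊤∣≡n _)) i≤n∸r
    d : ℕ
    d = proj₁ (higherWeight-exists M i ⊤ i≤nullity[E])
    d-is-dᵢ : IsHigherWeight M i d
    d-is-dᵢ = proj₂ (higherWeight-exists M i ⊤ i≤nullity[E])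
    d-least : IsMin (λ s → DegP≡ M s i) d
    d-least = AtHigherWeight.least-degree M d-is-dᵢ
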